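{- Let $A$ be a closed type and let $S$ be a set of well-typed values of type $A$ (i.e. for each $v\in S$ there is a context $\Delta$ with $\Delta\vdash_e v:A$) such that $\mathtt{OD}_A(S)$ holds. Then for every closed value $v$ of type $A$ (i.e. $\vdash_e v : A$), there exist a unique $v'\in S$ and a unique substitution $\sigma$ such that $\sigma[v'] = v$.
   Context: Types are generated by $A,B ::= \mathbb{1} \mid A\oplus B \mid A\otimes B \mid \mu X.A \mid X$, where $\mu$ binds $X$; all types considered are closed, and $A[X\leftarrow C]$ denotes substitution of $C$ for $X$. Values are generated by $v ::= () \mid x \mid \mathtt{inl}\,v \mid \mathtt{inr}\,v \mid \langle v_1,v_2\rangle \mid \mathtt{fold}\,v$, with $x$ ranging over term variables. Typing of values, $\Delta\vdash_e v:A$, where $\Delta$ is a set of pairs $x:A$ in which each variable occurs at most once: $\emptyset\vdash_e ():\mathbb{1}$; $x:A\vdash_e x:A$; if $\Delta\vdash_e v:A$ then $\Delta\vdash_e \mathtt{inl}\,v:A\oplus B$; if $\Delta\vdash_e v:B$ then $\Delta\vdash_e\mathtt{inr}\,v:A\oplus B$; if $\Delta_1\vdash_e v_1:A$ and $\Delta_2\vdash_e v_2:B$ (disjoint contexts) then $\Delta_1,\Delta_2\vdash_e\langle v_1,v_2\rangle:A\otimes B$; if $\Delta\vdash_e v:A[X\leftarrow\mu X.A]$ then $\Delta\vdash_e \mathtt{fold}\,v:\mu X.A$. A value is closed if it has no variables ($\vdash_e v:A$ with empty context). The predicate $\mathtt{OD}_A(S)$ on finite sets of values is defined inductively: $\mathtt{OD}_A(\{x\})$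 for a variable $x$; $\mathtt{OD}_{\mathbb{1}}(\{()\})$; if $\mathtt{OD}_A(S)$ and $\mathtt{OD}_B(T)$ then $\mathtt{OD}_{A\oplus B}(\{\mathtt{inl}\,v\mid v\in S\}\cup\{\mathtt{inr}\,v\mid v\in T\})$; if $\mathtt{OD}_{A[X\leftarrow \mu X.A]}(S)$ then $\mathtt{OD}_{\mu X.A}(\{\mathtt{fold}\,v\mid v\in S\})$; for a set $S=\{\langle v_1,v_1'\rangle,\dots,\langle v_n,v_n'\rangle\}$ of pairs, $\mathtt{OD}_{A\otimes B}(S)$ holds if either ($\mathtt{OD}_A(\pi_1(S))$ and for all $v\in\pi_1(S)$, $\mathtt{OD}_B(\{w\mid\langle v,w\rangle\in S\})$) or ($\mathtt{OD}_B(\pi_2(S))$ and for all $v\in\pi_2(S)$, $\mathtt{OD}_A(\{w\mid\langle w,v\rangle\in S\})$), where $\pi_1(S)=\{v\mid\langle v,w\rangle\in S\}$ and $\pi_2(S)=\{w\mid\langle v,w\rangle\in S\}$. A substitution $\sigma$ is a finite map from variables to values, with support $\mathrm{supp}(\sigma)$ its domain. Pattern matching $\sigma[v]=v'$ is defined by: $\sigma[x]=e$ when $\sigma=\{x\mapsto e\}$; $\sigma[()]=()$ (with $\sigma$ empty); $\sigma[\mathtt{inl}\,e]=\mathtt{inl}\,e'$ if $\sigma[e]=e'$; similarly for $\mathtt{inr}$ and $\mathtt{fold}$; $\sigma[\langle e_1,e_2\rangle]=\langle e_1',e_2'\rangle$ if $\sigma_1[e_1]=e_1'$, $\sigma_2[e_2]=e_2'$,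 $\mathrm{supp}(\sigma_1)\cap\mathrm{supp}(\sigma_2)=\emptyset$ and $\sigma=\sigma_1\cup\sigma_2$. -}

module Defs where

open import Data.Nat using (ℕ; zero; suc; _≟_)
open import Data.Fin using (Fin; zero; suc)
open import Data.List using (List; []; _∷_; _++_; map)
open import Data.List.Membership.Propositional using (_∈_; _∉_)
open import Data.Maybe using (Maybe; just; nothing)
open import Data.Product using (_×_; _,_; proj₁; ∃; ∃-syntax)
open import Data.Sum using (_⊎_)
open import Relation.Nullary using (yes; no)
open import Relation.Binary.PropositionalEquality using (_≡_)
open import Function.Bundles using (_⇔_)

-- Types, with de Bruijn indices for the μ-bound type variables.
-- Ty n = types with at most n free type variables; closed types = Ty 0.

data Ty (n : ℕ) : Set where
  𝟙   : Ty n
  _⊕_ : Ty n → Ty n → Ty n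
  _⊗_ : Ty n → Ty n → Ty n
  μ   : Ty (suc n) → Ty n
  tv  : Fin n → Ty n

ext : ∀ {n m} → (Fin n → Fin m) → Fin (suc n) → Fin (suc m)
ext ρ zero    = zero
ext ρ (suc i) = suc (ρ i)

ren : ∀ {n m} → (Fin n → Fin m) → Ty n → Ty m
ren ρ 𝟙       = 𝟙
ren ρ (A ⊕ B) = ren ρ A ⊕ ren ρ B
ren ρ (A ⊗ B) = ren ρ A ⊗ ren ρ B
ren ρ (μ A)   = μ (ren (ext ρ) A)
ren ρ (tv i)  = tv (ρ i)

exts : ∀ {n m} → (Fin n → Ty m) → Fin (suc n) → Ty (suc m)
exts σ zero    = tv zero
exts σ (suc i) = ren suc (σ i)

sub : ∀ {n m} → (Fin n → Ty m) → Ty n → Ty m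
sub σ 𝟙       = 𝟙
sub σ (A ⊕ B) = sub σ A ⊕ sub σ B
sub σ (A ⊗ B) = sub σ A ⊗ sub σ B
sub σ (μ A)   = μ (sub (exts σ) A)
sub σ (tv i)  = σ i

-- A [X ← C] where X is the outermost bound variable (index 0)
_[X←_] : ∀ {n} → Ty (suc n) → Ty n → Ty n
A [X← C ] = sub (λ { zero → C ; (suc i) → tv i }) A

Var : Set
Var = ℕ

data Val : Set where
  unit : Val
  var  : Var → Val
  inl  : Val → Val
  inr  : Val → Val
  pair : Val → Val → Val
  fold : Val → Val

-- A context is a list of pairs x : A; disjoint union
-- of contexts is concatenation with disjoint variable sets (so each
-- variable occurs at most once in any derivable context).

Ctx : Set
Ctx = List (Var × Ty 0)

dom : Ctx → List Var
dom = map proj₁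

data _⊢e_∶_ : Ctx → Val → Ty 0 → Set where
  ⊢unit : [] ⊢e unit ∶ 𝟙
  ⊢var  : ∀ {x A} → ((x , A) ∷ []) ⊢e var x ∶ A
  ⊢inl  : ∀ {Δ v A B} → Δ ⊢e v ∶ A → Δ ⊢e inl v ∶ (A ⊕ B)
  ⊢inr  : ∀ {Δ v A B} → Δ ⊢e v ∶ B → Δ ⊢e inr v ∶ (A ⊕ B)
  ⊢pair : ∀ {Δ₁ Δ₂ v₁ v₂ A B} → Δ₁ ⊢e v₁ ∶ A → Δ₂ ⊢e v₂ ∶ B →
          (∀ x → x ∈ dom Δ₁ → x ∉ dom Δ₂) →
          (Δ₁ ++ Δ₂) ⊢e pair v₁ v₂ ∶ (A ⊗ B)
  ⊢fold : ∀ {Δ v A} → Δ ⊢e v ∶ (A [X← μ A ]) → Δ ⊢e fold v ∶ μ A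

-- Sets of values are predicates on Val; equality of sets is extensional.

VSet : Set₁
VSet = Val → Set

π₁ : VSet → VSet
π₁ S a = ∃[ w ] S (pair a w)

π₂ : VSet → VSet
π₂ S b = ∃[ w ] S (pair w b)

data OD : Ty 0 → VSet → Set₁ where
  od-var  : ∀ {A S} (x : Var) → (∀ v → S v ⇔ (v ≡ var x)) → OD A S
  od-unit : ∀ {S} → (∀ v → S v ⇔ (v ≡ unit)) → OD 𝟙 S
  od-sum  : ∀ {A B S T U} → OD A S → OD B T →
            (∀ v → U v ⇔ ((∃[ w ] (S w × v ≡ inl w)) ⊎ (∃[ w ] (T w × v ≡ inr w)))) →
            OD (A ⊕ B) U
  od-fold : ∀ {A S U} → OD (A [X← μ A ]) S →
            (∀ v → U v ⇔ (∃[ w ] (S w × v ≡ fold w))) →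
            OD (μ A) U
  od-pair₁ : ∀ {A B S} → (∀ v → S v → ∃[ a ] ∃[ b ] (v ≡ pair a b)) →
             OD A (π₁ S) → (∀ a → π₁ S a → OD B (λ w → S (pair a w))) →
             OD (A ⊗ B) S
  od-pair₂ : ∀ {A B S} → (∀ v → S v → ∃[ a ] ∃[ b ] (v ≡ pair a b)) →
             OD B (π₂ S) → (∀ b → π₂ S b → OD A (λ w → S (pair w b))) →
             OD (A ⊗ B) S

-- Substitutions: finite maps Var ⇀ Val, represented as partial functions
-- (equality of maps is pointwise).  Support = {x | σ x ≢ nothing}.

Subst : Set
Subst = Var → Maybe Val

_≗ₛ_ : Subst → Subst → Set
σ ≗ₛ τ = ∀ x → σ x ≡ τ x

∅ₛ : Subst
∅ₛ _ = nothing

_↦_ : Var → Val → Subst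
(x ↦ e) y with y ≟ x
... | yes _ = just e
... | no  _ = nothing

_∪ₛ_ : Subst → Subst → Subst
(σ ∪ₛ τ) x with σ x
... | just e  = just e
... | nothing = τ x

DisjointSupp : Subst → Subst → Set
DisjointSupp σ τ = ∀ x → (σ x ≡ nothing) ⊎ (τ x ≡ nothing)

-- Match σ p v  means  σ[p] = v
data Match : Subst → Val → Val → Set where
  m-var  : ∀ {σ x e} → σ ≗ₛ (x ↦ e) → Match σ (var x) e
  m-unit : ∀ {σ} → σ ≗ₛ ∅ₛ → Match σ unit unit
  m-inl  : ∀ {σ p e} → Match σ p e → Match σ (inl p) (inl e)
  m-inr  : ∀ {σ p e} → Match σ p e → Match σ (inr p) (inr e)
  m-fold : ∀ {σ p e} → Match σ p e → Match σ (fold p) (fold e)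
  m-pair : ∀ {σ σ₁ σ₂ p₁ p₂ e₁ e₂} → Match σ₁ p₁ e₁ → Match σ₂ p₂ e₂ →
           DisjointSupp σ₁ σ₂ → σ ≗ₛ (σ₁ ∪ₛ σ₂) →
           Match σ (pair p₁ p₂) (pair e₁ e₂)

{-# OPTIONS --safe #-}
module Submission where

-- An OD set either consists of a single variable, which matches anything,
-- or splits values by their outermost constructor (sums, folds), or first
-- by one component of a pair and then, within the fibre, by the other.
-- Following this decomposition along a closed value, which is never a
-- variable, produces a matching pattern; along two matching patterns it
-- forces them to coincide.  The substitution is then determined by pattern
-- and value.  Typing is needed only to see that the two halves of a pair
-- pattern are matched by substitutions with disjoint supports: they live in
-- the disjoint contexts of the two components.

open import Defs
open import Data.List using ([]; _++_)
open import Data.List.Properties using (++-conicalˡ; ++-conicalʳ; map-++)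
open import Data.List.Membership.Propositional using (_∈_)
open import Data.List.Membership.Propositional.Properties using (∈-++⁺ˡ; ∈-++⁺ʳ)
open import Data.List.Relation.Unary.Any using (here)
open import Data.Maybe using (just; nothing)
open import Data.Nat using (_≟_)
open import Data.Product using (_×_; _,_; proj₁; proj₂; ∃-syntax)
open import Data.Sum using (_⊎_; inj₁; inj₂)
open import Data.Empty using (⊥-elim)
open import Function.Bundles using (Equivalence)
open import Relation.Nullary using (yes; no)
open import Relation.Binary.PropositionalEquality

open Equivalence

private
  variable
    A B : Ty 0
    Δ : Ctx
    S U : VSet
    σ τ σ₁ σ₂ τ₁ τ₂ : Subst
    a b p q v : Val

∪ₛ-cong : σ₁ ≗ₛ τ₁ → σ₂ ≗ₛ τ₂ → (σ₁ ∪ₛ σ₂) ≗ₛ (τ₁ ∪ₛ τ₂)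
∪ₛ-cong {σ₁} {τ₁} σ₁≗τ₁ σ₂≗τ₂ y with σ₁ y | τ₁ y | σ₁≗τ₁ y
... | just e  | .(just e) | refl = refl
... | nothing | .nothing  | refl = σ₂≗τ₂ y

∪ₛ-nothing : ∀ {y} → σ₁ y ≡ nothing → σ₂ y ≡ nothing → (σ₁ ∪ₛ σ₂) y ≡ nothing
∪ₛ-nothing {σ₁} {y = y} σ₁y≡nothing σ₂y≡nothing with σ₁ y
... | nothing = σ₂y≡nothing

↦-supp : ∀ (y : Var) e z → z ≡ y ⊎ (y ↦ e) z ≡ nothing
↦-supp y e z with z ≟ y
... | yes z≡y = inj₁ z≡y
... | no  _   = inj₂ refl

Match-functional : Match σ p v → Match τ p v → σ ≗ₛ τ
Match-functional (m-var σ≗) (m-var τ≗) y = trans (σ≗ y) (sym (τ≗ y))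
Match-functional (m-unit σ≗) (m-unit τ≗) y = trans (σ≗ y) (sym (τ≗ y))
Match-functional (m-inl m) (m-inl n) = Match-functional m n
Match-functional (m-inr m) (m-inr n) = Match-functional m n
Match-functional (m-fold m) (m-fold n) = Match-functional m n
Match-functional (m-pair m₁ m₂ _ σ≗) (m-pair n₁ n₂ _ τ≗) y =
  trans (σ≗ y) (trans (∪ₛ-cong (Match-functional m₁ n₁) (Match-functional m₂ n₂) y) (sym (τ≗ y)))

dom-++⁺ˡ : ∀ {y} Δ₁ Δ₂ → y ∈ dom Δ₁ → y ∈ dom (Δ₁ ++ Δ₂)
dom-++⁺ˡ Δ₁ Δ₂ y∈ = subst (_ ∈_) (sym (map-++ proj₁ Δ₁ Δ₂)) (∈-++⁺ˡ y∈)

dom-++⁺ʳ : ∀ {y} Δ₁ Δ₂ → y ∈ dom Δ₂ → y ∈ dom (Δ₁ ++ Δ₂)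
dom-++⁺ʳ Δ₁ Δ₂ y∈ = subst (_ ∈_) (sym (map-++ proj₁ Δ₁ Δ₂)) (∈-++⁺ʳ (dom Δ₁) y∈)

Match-supp⊆dom : Match σ p v → Δ ⊢e p ∶ A → ∀ y → σ y ≡ nothing ⊎ y ∈ dom Δ
Match-supp⊆dom (m-var {x = x} {e = e} σ≗) ⊢var y with ↦-supp x e y
... | inj₁ refl         = inj₂ (here refl)
... | inj₂ ↦y≡nothing = inj₁ (trans (σ≗ y) ↦y≡nothing)
Match-supp⊆dom (m-unit σ≗) ⊢unit y = inj₁ (σ≗ y)
Match-supp⊆dom (m-inl m) (⊢inl d) = Match-supp⊆dom m d
Match-supp⊆dom (m-inr m) (⊢inr d) = Match-supp⊆dom m d
Match-supp⊆dom (m-fold m) (⊢fold d) = Match-supp⊆dom m d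
Match-supp⊆dom (m-pair {σ₁ = σ₁} {σ₂ = σ₂} m₁ m₂ _ σ≗) (⊢pair {Δ₁ = Δ₁} {Δ₂ = Δ₂} d₁ d₂ _) y
  with Match-supp⊆dom m₁ d₁ y | Match-supp⊆dom m₂ d₂ y
... | inj₂ y∈Δ₁ | _         = inj₂ (dom-++⁺ˡ Δ₁ Δ₂ y∈Δ₁)
... | inj₁ _    | inj₂ y∈Δ₂ = inj₂ (dom-++⁺ʳ Δ₁ Δ₂ y∈Δ₂)
... | inj₁ σ₁y  | inj₁ σ₂y  = inj₁ (trans (σ≗ y) (∪ₛ-nothing {σ₁} {σ₂} σ₁y σ₂y))

Match-pair-disjoint : Match σ₁ a p → Match σ₂ b q → Δ ⊢e pair a b ∶ (A ⊗ B) →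
                      DisjointSupp σ₁ σ₂
Match-pair-disjoint m₁ m₂ (⊢pair d₁ d₂ disjoint) y
  with Match-supp⊆dom m₁ d₁ y | Match-supp⊆dom m₂ d₂ y
... | inj₁ σ₁y  | _         = inj₁ σ₁y
... | inj₂ _    | inj₁ σ₂y  = inj₂ σ₂y
... | inj₂ y∈Δ₁ | inj₂ y∈Δ₂ = ⊥-elim (disjoint y y∈Δ₁ y∈Δ₂)

⊢inl⁻¹ : Δ ⊢e inl v ∶ (A ⊕ B) → Δ ⊢e v ∶ A
⊢inl⁻¹ (⊢inl d) = d

⊢inr⁻¹ : Δ ⊢e inr v ∶ (A ⊕ B) → Δ ⊢e v ∶ B
⊢inr⁻¹ (⊢inr d) = d

⊢fold⁻¹ : ∀ {F} → Δ ⊢e fold v ∶ μ F → Δ ⊢e v ∶ (F [X← μ F ])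
⊢fold⁻¹ (⊢fold d) = d

⊢pair⁻¹ : Δ ⊢e pair a b ∶ (A ⊗ B) → (∃[ Δ₁ ] (Δ₁ ⊢e a ∶ A)) × (∃[ Δ₂ ] (Δ₂ ⊢e b ∶ B))
⊢pair⁻¹ (⊢pair d₁ d₂ _) = (_ , d₁) , (_ , d₂)

-- Phrased with Δ ≡ [] because Δ₁ ++ Δ₂ does not unify with [].
closed-⊗⁻¹ : Δ ≡ [] → Δ ⊢e v ∶ (A ⊗ B) →
             ∃[ a ] ∃[ b ] (v ≡ pair a b × [] ⊢e a ∶ A × [] ⊢e b ∶ B)
closed-⊗⁻¹ () ⊢var
closed-⊗⁻¹ Δ≡[] (⊢pair {Δ₁ = Δ₁} {Δ₂ = Δ₂} d₁ d₂ _)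
  with ++-conicalˡ Δ₁ Δ₂ Δ≡[] | ++-conicalʳ Δ₁ Δ₂ Δ≡[]
... | refl | refl = _ , _ , refl , d₁ , d₂

Typed : Ty 0 → VSet → Set
Typed A S = ∀ v → S v → ∃[ Δ ] (Δ ⊢e v ∶ A)

Typed-preimage : (f : Val → Val) → (∀ {Δ v} → Δ ⊢e f v ∶ B → Δ ⊢e v ∶ A) →
                 (∀ v → S v → U (f v)) → Typed B U → Typed A S
Typed-preimage f inv S⊆f⁻¹U typedU v s
  with typedU (f v) (S⊆f⁻¹U v s)
... | Δ , d = Δ , inv d

Typed-π₁ : Typed (A ⊗ B) S → Typed A (π₁ S)
Typed-π₁ typed _ (_ , s) = proj₁ (⊢pair⁻¹ (proj₂ (typed _ s)))

Typed-π₂ : Typed (A ⊗ B) S → Typed B (π₂ S)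
Typed-π₂ typed _ (_ , s) = proj₂ (⊢pair⁻¹ (proj₂ (typed _ s)))

Typed-fibre₁ : Typed (A ⊗ B) S → Typed B (λ w → S (pair a w))
Typed-fibre₁ typed _ s = proj₂ (⊢pair⁻¹ (proj₂ (typed _ s)))

Typed-fibre₂ : Typed (A ⊗ B) S → Typed A (λ w → S (pair w b))
Typed-fibre₂ typed _ s = proj₁ (⊢pair⁻¹ (proj₂ (typed _ s)))

MatchedIn : VSet → Val → Set
MatchedIn S v = ∃[ p ] ∃[ σ ] (S p × Match σ p v)

MatchedIn-map : (c : Val → Val) → (∀ {σ p v} → Match σ p v → Match σ (c p) (c v)) →
                (∀ w → S w → U (c w)) → MatchedIn S v → MatchedIn U (c v)
MatchedIn-map c match-c S⊆c⁻¹U (p , σ , s , m) = c p , σ , S⊆c⁻¹U p s , match-c m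

OD-match-exists : OD A S → Typed A S → [] ⊢e v ∶ A → MatchedIn S v
OD-match-exists {v = v} (od-var x S≡) _ _ =
  var x , (x ↦ v) , from (S≡ (var x)) refl , m-var (λ _ → refl)
OD-match-exists (od-unit S≡) _ ⊢unit =
  unit , ∅ₛ , from (S≡ unit) refl , m-unit (λ _ → refl)
OD-match-exists {S = U} (od-sum {S = S} odA _ U≡) typed (⊢inl d) =
  MatchedIn-map inl m-inl inl∈U (OD-match-exists odA (Typed-preimage inl ⊢inl⁻¹ inl∈U typed) d)
  where
  inl∈U : ∀ w → S w → U (inl w)
  inl∈U w s = from (U≡ (inl w)) (inj₁ (w , s , refl))
OD-match-exists {S = U} (od-sum {T = T} _ odB U≡) typed (⊢inr d) =
  MatchedIn-map inr m-inr inr∈U (OD-match-exists odB (Typed-preimage inr ⊢inr⁻¹ inr∈U typed) d)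
  where
  inr∈U : ∀ w → T w → U (inr w)
  inr∈U w t = from (U≡ (inr w)) (inj₂ (w , t , refl))
OD-match-exists {S = U} (od-fold {S = S} od U≡) typed (⊢fold d) =
  MatchedIn-map fold m-fold fold∈U (OD-match-exists od (Typed-preimage fold ⊢fold⁻¹ fold∈U typed) d)
  where
  fold∈U : ∀ w → S w → U (fold w)
  fold∈U w s = from (U≡ (fold w)) (w , s , refl)
OD-match-exists (od-pair₁ _ od₁ od₂) typed d with closed-⊗⁻¹ refl d
... | _ , _ , refl , d₁ , d₂ with OD-match-exists od₁ (Typed-π₁ typed) d₁
... | p₁ , σ₁ , (w , s₁) , m₁ with OD-match-exists (od₂ p₁ (w , s₁)) (Typed-fibre₁ typed) d₂
... | p₂ , σ₂ , s , m₂ =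
  pair p₁ p₂ , (σ₁ ∪ₛ σ₂) , s ,
  m-pair m₁ m₂ (Match-pair-disjoint m₁ m₂ (proj₂ (typed _ s))) (λ _ → refl)
OD-match-exists (od-pair₂ _ od₂ od₁) typed d with closed-⊗⁻¹ refl d
... | _ , _ , refl , d₁ , d₂ with OD-match-exists od₂ (Typed-π₂ typed) d₂
... | p₂ , σ₂ , (w , s₂) , m₂ with OD-match-exists (od₁ p₂ (w , s₂)) (Typed-fibre₂ typed) d₁
... | p₁ , σ₁ , s , m₁ =
  pair p₁ p₂ , (σ₁ ∪ₛ σ₂) , s ,
  m-pair m₁ m₂ (Match-pair-disjoint m₁ m₂ (proj₂ (typed _ s))) (λ _ → refl)

OD-match-unique : OD A S → S p → S q → Match σ p v → Match τ q v → p ≡ q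
OD-match-unique (od-var _ S≡) sp sq _ _ = trans (to (S≡ _) sp) (sym (to (S≡ _) sq))
OD-match-unique (od-unit S≡) sp sq _ _ = trans (to (S≡ _) sp) (sym (to (S≡ _) sq))
OD-match-unique (od-sum odA odB U≡) sp sq m n with to (U≡ _) sp | to (U≡ _) sq
OD-match-unique (od-sum odA odB U≡) _ _ (m-inl m) (m-inl n)
  | inj₁ (_ , sp , refl) | inj₁ (_ , sq , refl) = cong inl (OD-match-unique odA sp sq m n)
OD-match-unique (od-sum odA odB U≡) _ _ (m-inr m) (m-inr n)
  | inj₂ (_ , sp , refl) | inj₂ (_ , sq , refl) = cong inr (OD-match-unique odB sp sq m n)
OD-match-unique (od-sum _ _ _) _ _ (m-inl _) ()
  | inj₁ (_ , _ , refl) | inj₂ (_ , _ , refl)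
OD-match-unique (od-sum _ _ _) _ _ (m-inr _) ()
  | inj₂ (_ , _ , refl) | inj₁ (_ , _ , refl)
OD-match-unique (od-fold od U≡) sp sq m n with to (U≡ _) sp | to (U≡ _) sq
OD-match-unique (od-fold od U≡) _ _ (m-fold m) (m-fold n)
  | _ , sp , refl | _ , sq , refl = cong fold (OD-match-unique od sp sq m n)
OD-match-unique (od-pair₁ shape od₁ od₂) sp sq m n with shape _ sp | shape _ sq
OD-match-unique (od-pair₁ shape od₁ od₂) sp sq (m-pair m₁ m₂ _ _) (m-pair n₁ n₂ _ _)
  | _ , _ , refl | _ , _ , refl
  with OD-match-unique od₁ (_ , sp) (_ , sq) m₁ n₁
... | refl = cong (pair _) (OD-match-unique (od₂ _ (_ , sp)) sp sq m₂ n₂)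
OD-match-unique (od-pair₂ shape od₂ od₁) sp sq m n with shape _ sp | shape _ sq
OD-match-unique (od-pair₂ shape od₂ od₁) sp sq (m-pair m₁ m₂ _ _) (m-pair n₁ n₂ _ _)
  | _ , _ , refl | _ , _ , refl
  with OD-match-unique od₂ (_ , sp) (_ , sq) m₂ n₂
... | refl = cong (λ p₁ → pair p₁ _) (OD-match-unique (od₁ _ (_ , sp)) sp sq m₁ n₁)

mainTheorem1 : (A : Ty 0) (S : VSet) →
    (∀ v → S v → ∃[ Δ ] (Δ ⊢e v ∶ A)) →
    OD A S →
    (v : Val) → [] ⊢e v ∶ A →
    ∃[ v′ ] ∃[ σ ] ((S v′ × Match σ v′ v) ×
      (∀ v″ σ′ → S v″ → Match σ′ v″ v → (v″ ≡ v′) × (σ′ ≗ₛ σ)))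
mainTheorem1 _ S typed od v ⊢v with OD-match-exists od typed ⊢v
... | p , σ , sp , m = p , σ , (sp , m) , unique
  where
  unique : ∀ q τ → S q → Match τ q v → (q ≡ p) × (τ ≗ₛ σ)
  unique q τ sq n with OD-match-unique od sq sp n m
  ... | refl = refl , Match-functional n m
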